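{- Let $G_1,\dots,G_t$ be connected grid graphs, each with exactly $n$ vertices, and let $\langle G,n,\mathsf{init},\mathsf{fin}\rangle=\mathsf{HamToSna}(G_1,\dots,G_t)$ (with the columns $c_i$ as in the construction). For every $1\le i\le t$ let $\mathsf{init}_i=((n+1,c_i),(n,c_i),(n-1,c_i),(n-1,c_i-1),\dots,(n-1,c_i-(n-3)))$. Then $\langle G,n,\mathsf{init},\mathsf{fin}\rangle$ is a Yes-instance of Snake Game if and only if $\langle G,n,\mathsf{init}_i,\mathsf{fin}\rangle$ is a Yes-instance of Snake Game for some $1\le i\le t$.
   Context: A grid graph is a finite undirected graph $G$ with $V(G)\subseteq\{(i,j):i,j\in\mathbb{N}_0\}$ and $\{(i,j),(i',j')\}\in E(G)$ iff $|i-i'|+|j-j'|=1$. Snake Game: for an undirected graph $G$ and $k\in\mathbb{N}$, a configuration is a tuple $(v_1,\dots,v_k)$ of pairwise distinct vertices with $\{v_i,v_{i+1}\}\in E(G)$; $((v_1,\dots,v_k),(v'_1,\dots,v'_k))$ is a $1$-transition if $v'_1\ne v_i$ for $1\le i\le k-1$ and $v'_i=v_{i-1}$ for $2\le i\le k$; $\langle G,k,\mathsf{init},\mathsf{fin}\rangle$ is a Yes-instance iff there is a sequence $\mathsf{init}=\mathsf{conf}_1,\dots,\mathsf{conf}_{\ell+1}=\mathsf{fin}$ ($\ell\ge1$) of configurations with each consecutive pair a $1$-transition. Construction $\mathsf{HamToSna}(G_1,\dots,G_t)$ for connected grid graphs $G_1,\dots,G_t$ each with $n$ vertices: for each $i$,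 let $\hat r^i$ (resp. $\hat c^i$) be the minimum first (resp. second) coordinate of a vertex of $G_i$, and replace every vertex $(a,b)$ of $G_i$ by $(a-\hat r^i+(n+1),\,b-\hat c^i+i(n+1))$ (a translation; call the result again $G_i$). Then some vertex of $G_i$ has first coordinate $n+1$; choose one arbitrarily and denote it $(n+1,c_i)$. Let $V(G)=V^{1}\cup V^{2}\cup V^{3}$ with $V^{1}=\{(n-1,j):0\le j\le n-1\}\cup\{(i,n-2):0\le i\le n-1\}$, $V^{2}=\{(n-1,j):n\le j\le c_t\}\cup\{(n,c_i):1\le i\le t\}$, $V^{3}=\bigcup_{i=1}^tV(G_i)$; $E(G)$ consists of all pairs of vertices of $V(G)$ at $\ell_1$-distance $1$. The snake size is $n$, $\mathsf{init}=((n-1,n-1),(n-1,n-2),\dots,(n-1,0))$ and $\mathsf{fin}=((0,n-2),(1,n-2),\dots,(n-1,n-2))$. -}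

module Defs where

open import Data.Nat using (ℕ; zero; suc; _+_; _*_; _∸_; _≤_; _<_; _⊓_; ∣_-_∣)
open import Data.Fin using (Fin; toℕ; fromℕ)
open import Data.Product using (_×_; _,_; Σ; ∃; ∃-syntax; proj₁; proj₂)
open import Data.Sum using (_⊎_)
open import Data.List using (List; []; _∷_; map; foldr; length; upTo; downFrom)
open import Data.List.Relation.Unary.All using (All)
open import Data.List.Relation.Unary.Unique.Propositional using (Unique)
open import Data.List.Relation.Unary.Linked using (Linked)
open import Data.List.Membership.Propositional using (_∈_)
open import Relation.Binary.PropositionalEquality using (_≡_; _≢_)
open import Relation.Binary.Construct.Closure.Transitive using (Plus)
open import Relation.Binary.Construct.Closure.ReflexiveTransitive using (Star)

Pt : Set
Pt = ℕ × ℕ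

adj : Pt → Pt → Set
adj (a , b) (a' , b') = ∣ a - a' ∣ + ∣ b - b' ∣ ≡ 1

-- Grid graphs given by their (duplicate-free) vertex list;
-- edges are all pairs at ℓ1-distance 1.

GridEdge : List Pt → Pt → Pt → Set
GridEdge vs u v = u ∈ vs × v ∈ vs × adj u v

Connected : List Pt → Set
Connected vs = ∀ {u v} → u ∈ vs → v ∈ vs → Star (GridEdge vs) u v

module Snake {A : Set} (V : A → Set) (E : A → A → Set) where

  Config : ℕ → List A → Set
  Config k xs = length xs ≡ k × All V xs × Unique xs × Linked E xs

  dropLast : List A → List A
  dropLast []           = []
  dropLast (x ∷ [])     = []
  dropLast (x ∷ y ∷ ys) = x ∷ dropLast (y ∷ ys)

  OneTransition : List A → List A → Set
  OneTransition xs ys = ∃[ w ] (ys ≡ w ∷ dropLast xs × All (λ v → w ≢ v) (dropLast xs))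

  Step : ℕ → List A → List A → Set
  Step k xs ys = Config k xs × Config k ys × OneTransition xs ys

  YesInstance : ℕ → List A → List A → Set
  YesInstance k init fin = Plus (Step k) init fin

minimum : List ℕ → ℕ
minimum []       = 0
minimum (x ∷ xs) = foldr _⊓_ x xs

-- translation of the i-th graph (i ∈ Fin t stands for index toℕ i + 1)
translate : ∀ {t} → ℕ → Fin t → List Pt → List Pt
translate {t} n i vs = map shift vs
  where
  r̂ = minimum (map proj₁ vs)
  ĉ = minimum (map proj₂ vs)
  shift : Pt → Pt
  shift (a , b) = (a ∸ r̂ + suc n , b ∸ ĉ + suc (toℕ i) * suc n)

-- vertex set of G; here t = suc m, graphs gs, chosen columns c
module _ (n m : ℕ) (gs : Fin (suc m) → List Pt) (c : Fin (suc m) → ℕ) where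

  V¹ : Pt → Set
  V¹ p = (∃[ j ] (j < n × p ≡ (n ∸ 1 , j))) ⊎ (∃[ i ] (i < n × p ≡ (i , n ∸ 2)))

  V² : Pt → Set
  V² p = (∃[ j ] (n ≤ j × j ≤ c (fromℕ m) × p ≡ (n ∸ 1 , j)))
       ⊎ (∃[ i ] (p ≡ (n , c i)))

  V³ : Pt → Set
  V³ p = ∃[ i ] (p ∈ translate n i (gs i))

  HamToSnaV : Pt → Set
  HamToSnaV p = V¹ p ⊎ V² p ⊎ V³ p

initConf : ℕ → List Pt
initConf n = map (λ j → (n ∸ 1 , j)) (downFrom n)

finConf : ℕ → List Pt
finConf n = map (λ i → (i , n ∸ 2)) (upTo n)

initConfᵢ : ℕ → ℕ → List Pt
initConfᵢ n cᵢ = (suc n , cᵢ) ∷ (n , cᵢ) ∷ map (λ j → (n ∸ 1 , cᵢ ∸ j)) (upTo (n ∸ 2))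

module Submission where

-- Write r = n - 1. The initial snake lies in row r, columns n-1 … 0. Row r of
-- G is a path extending to column c_t, below it only the connector cells
-- (n , cᵢ) exist, and row n - 2 contains no vertex at columns ≥ n - 1. Hence
-- a snake lying horizontally in row r with head column h ≥ r has only two
-- legal moves: one step right, or — when h = cᵢ — one step down. After a
-- step down the only move is down again, into Gᵢ, reaching initᵢ. The
-- second claim needs the connector columns to be at distance ≥ 2, which
-- follows because a connected grid graph on n vertices spans fewer than n
-- columns, so the translated copies of the Gᵢ occupy disjoint column bands.

open import Defs
open import Data.Nat
open import Data.Nat.Properties
open import Data.Fin using (Fin; toℕ; fromℕ)
open import Data.Fin.Properties using (toℕ-injective; toℕ<n; ≤fromℕ; pigeonhole)
import Data.Fin.Properties as Fin
open import Data.Product using (_×_; _,_; ∃-syntax; proj₁; proj₂; uncurry)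
open import Data.Sum using (_⊎_; inj₁; inj₂)
open import Data.List using (List; []; _∷_; map; length; lookup; applyUpTo; downFrom)
open import Data.List.Properties using (length-map; map-applyUpTo; foldr-preservesᵒ)
open import Data.List.Relation.Unary.All using (All; []; _∷_)
import Data.List.Relation.Unary.Any as Any
open Any using (here; there)
open import Data.List.Relation.Unary.Any.Properties using (lookup-index)
open import Data.List.Relation.Unary.AllPairs using ([]; _∷_)
open import Data.List.Relation.Unary.Linked using ([-]; _∷_)
open import Data.List.Relation.Unary.Unique.Propositional using (Unique)
open import Data.List.Membership.Propositional using (_∈_)
open import Data.List.Membership.Propositional.Properties using (∈-map⁺; ∈-map⁻; foldr-selective)
open import Relation.Binary.PropositionalEquality
open import Relation.Binary.Construct.Closure.ReflexiveTransitive using (Star; ε; _◅_; _◅◅_)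
open import Relation.Binary.Construct.Closure.Transitive
  using (Plus; [_]; _∼⁺⟨_⟩_; TransClosure; _∷_; equivalent)
open import Relation.Binary.Definitions using (tri<; tri≈; tri>)
open import Relation.Nullary using (¬_; yes; no; contradiction)
open import Function.Bundles using (_⇔_; mk⇔; Equivalence)

data Neighbour : Pt → Pt → Set where
  right : ∀ {a b} → Neighbour (a , b) (a , suc b)
  left  : ∀ {a b} → Neighbour (a , suc b) (a , b)
  down  : ∀ {a b} → Neighbour (a , b) (suc a , b)
  up    : ∀ {a b} → Neighbour (suc a , b) (a , b)

dist-one : ∀ x y → ∣ x - y ∣ ≡ 1 → x ≡ suc y ⊎ suc x ≡ y
dist-one zero    y       e = inj₂ (sym e)
dist-one (suc x) zero    e = inj₁ (cong suc (cong pred e))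
dist-one (suc x) (suc y) e with dist-one x y e
... | inj₁ x≡1+y = inj₁ (cong suc x≡1+y)
... | inj₂ 1+x≡y = inj₂ (cong suc 1+x≡y)

∣n-1+n∣≡1 : ∀ n → ∣ n - suc n ∣ ≡ 1
∣n-1+n∣≡1 zero    = refl
∣n-1+n∣≡1 (suc n) = ∣n-1+n∣≡1 n

adj⇒Neighbour : ∀ {u v} → adj u v → Neighbour u v
adj⇒Neighbour {a , b} {a' , b'} d with ∣ a - a' ∣ in da | ∣ b - b' ∣ in db
... | 0 | 1 with ∣m-n∣≡0⇒m≡n {a} {a'} da | dist-one b b' db
...   | refl | inj₁ refl = left
...   | refl | inj₂ refl = right
adj⇒Neighbour {a , b} {a' , b'} d | 1 | 0 with ∣m-n∣≡0⇒m≡n {b} {b'} db | dist-one a a' da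
...   | refl | inj₁ refl = up
...   | refl | inj₂ refl = down

adj-left : ∀ a b → adj (a , suc b) (a , b)
adj-left a b rewrite ∣n-n∣≡0 a | ∣-∣-comm (suc b) b = ∣n-1+n∣≡1 b

adj-up : ∀ a b → adj (suc a , b) (a , b)
adj-up a b rewrite ∣-∣-comm (suc a) a | ∣n-1+n∣≡1 a | ∣n-n∣≡0 b = refl

column-step : ∀ {u v} → Neighbour u v → proj₂ v ≤ suc (proj₂ u)
column-step right = ≤-refl
column-step left  = m≤n⇒m≤1+n (n≤1+n _)
column-step down  = n≤1+n _
column-step up    = n≤1+n _

minimum-≤ : ∀ {xs z} → z ∈ xs → minimum xs ≤ z
minimum-≤ {x ∷ ys} {z} z∈ = foldr-preservesᵒ keeps x ys (bound z∈)
  where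
  keeps : ∀ a b → a ≤ z ⊎ b ≤ z → a ⊓ b ≤ z
  keeps a b (inj₁ a≤z) = m≤n⇒m⊓o≤n b a≤z
  keeps a b (inj₂ b≤z) = m≤n⇒o⊓m≤n a b≤z
  bound : z ∈ x ∷ ys → x ≤ z ⊎ Any.Any (_≤ z) ys
  bound (here z≡x)  = inj₁ (≤-reflexive (sym z≡x))
  bound (there z∈ys) = inj₂ (Any.map (λ z≡y → ≤-reflexive (sym z≡y)) z∈ys)

minimum-∈ : ∀ {xs z} → z ∈ xs → minimum xs ∈ xs
minimum-∈ {x ∷ ys} _ with foldr-selective ⊓-sel x ys
... | inj₁ min≡x  = here min≡x
... | inj₂ min∈ys = there min∈ys

distinct-members-bound : ∀ {A : Set} (xs : List A) {k} (f : Fin k → A)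
  → (∀ {i j} → f i ≡ f j → i ≡ j) → (∀ j → f j ∈ xs) → k ≤ length xs
distinct-members-bound xs {k} f f-inj f∈ with k ≤? length xs
... | yes k≤len = k≤len
... | no  k≰len with pigeonhole (≰⇒> k≰len) (λ j → Any.index (f∈ j))
...   | i , j , i<j , same-pos = contradiction (f-inj fi≡fj) (Fin.<⇒≢ i<j)
  where
  fi≡fj : f i ≡ f j
  fi≡fj = trans (lookup-index (f∈ i)) (trans (cong (lookup xs) same-pos) (sym (lookup-index (f∈ j))))

path-columns : ∀ vs {u x} → u ∈ vs → Star (GridEdge vs) u x
  → ∀ y → proj₂ u ≤ y → y ≤ proj₂ x → ∃[ w ] (w ∈ vs × proj₂ w ≡ y)
path-columns vs {u} u∈ ε y u≤y y≤x = u , u∈ , ≤-antisym u≤y y≤x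
path-columns vs {u} u∈ ((_ , u'∈ , u~u') ◅ path) y u≤y y≤x with proj₂ u ≟ y
... | yes u≡y = u , u∈ , u≡y
... | no  u≢y = path-columns vs u'∈ path y
                  (≤-trans (column-step (adj⇒Neighbour {u} u~u')) (≤∧≢⇒< u≤y u≢y)) y≤x

column-span : ∀ {vs} → Connected vs → ∀ {x} → x ∈ vs
  → proj₂ x ∸ minimum (map proj₂ vs) < length vs
column-span {vs} conn {x} x∈ = subst (proj₂ x ∸ ĉ <_) (length-map proj₂ vs)
  (distinct-members-bound (map proj₂ vs) column column-injective column∈)
  where
  ĉ : ℕ
  ĉ = minimum (map proj₂ vs)
  ĉ≤x : ĉ ≤ proj₂ x
  ĉ≤x = minimum-≤ (∈-map⁺ proj₂ x∈)
  leftmost : ∃[ u ] (u ∈ vs × ĉ ≡ proj₂ u)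
  leftmost = ∈-map⁻ proj₂ (minimum-∈ (∈-map⁺ proj₂ x∈))
  u∈ : proj₁ leftmost ∈ vs
  u∈ = proj₁ (proj₂ leftmost)
  ĉ≡u : ĉ ≡ proj₂ (proj₁ leftmost)
  ĉ≡u = proj₂ (proj₂ leftmost)
  column : Fin (suc (proj₂ x ∸ ĉ)) → ℕ
  column j = ĉ + toℕ j
  column-injective : ∀ {i j} → column i ≡ column j → i ≡ j
  column-injective eq = toℕ-injective (+-cancelˡ-≡ ĉ _ _ eq)
  column∈ : ∀ j → column j ∈ map proj₂ vs
  column∈ j with path-columns vs u∈ (conn u∈ x∈) (column j)
                   (subst (_≤ column j) ĉ≡u (m≤m+n ĉ (toℕ j)))
                   (subst (column j ≤_) (m+[n∸m]≡n ĉ≤x) (+-monoʳ-≤ ĉ (s≤s⁻¹ (toℕ<n j))))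
  ... | w , w∈ , w≡ = subst (_∈ map proj₂ vs) w≡ (∈-map⁺ proj₂ w∈)

translate-row : ∀ n {t} (i : Fin t) vs {q} → q ∈ translate n i vs → n < proj₁ q
translate-row n i vs q∈ with ∈-map⁻ _ q∈
... | _ , _ , refl = m≤n+m _ _

translate-col : ∀ n {t} (i : Fin t) {vs} → Connected vs → ∀ {q} → q ∈ translate n i vs
  → suc (toℕ i) * suc n ≤ proj₂ q × proj₂ q < suc (toℕ i) * suc n + length vs
translate-col n i {vs} conn q∈ with ∈-map⁻ _ q∈
... | (a , b) , x∈ , refl = m≤n+m _ _ ,
      subst (_< lo + length vs) (+-comm lo (b ∸ minimum (map proj₂ vs)))
            (+-monoʳ-< lo (column-span conn x∈))
  where
  lo : ℕ
  lo = suc (toℕ i) * suc n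

_◅◅⁺_ : ∀ {A : Set} {R : A → A → Set} {x y z} → Star R x y → Plus R y z → Plus R x z
ε        ◅◅⁺ q = q
(s ◅ ss) ◅◅⁺ q = _ ∼⁺⟨ [ s ] ⟩ (ss ◅◅⁺ q)

module SnakeFacts {A : Set} (V : A → Set) (E : A → A → Set) where
  open Snake V E

  config-[_] : ∀ {x} → V x → Config 1 (x ∷ [])
  config-[ vx ] = refl , vx ∷ [] , [] ∷ [] , [-]

  config-∷ : ∀ {k x y ys} → V x → E x y → All (x ≢_) (y ∷ ys)
    → Config k (y ∷ ys) → Config (suc k) (x ∷ y ∷ ys)
  config-∷ vx exy x∉ (refl , vs , distinct , linked) = refl , vx ∷ vs , x∉ ∷ distinct , exy ∷ linked

  -- Moving into a legal configuration w ∷ dropLast xs is a legal move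
  -- (freshness of w is part of the target being a configuration).
  advance : ∀ {k xs w ys} → dropLast xs ≡ ys → Config k xs → Config k (w ∷ ys)
    → Step k xs (w ∷ ys)
  advance refl cxs cys@(_ , _ , w∉ ∷ _ , _) = cxs , cys , (_ , refl , w∉)

  new-head : ∀ {k x y z zs ys} → Step k (x ∷ y ∷ z ∷ zs) ys
    → ∃[ w ] (ys ≡ w ∷ dropLast (x ∷ y ∷ z ∷ zs) × V w × E w x × w ≢ y)
  new-head (_ , (_ , vw ∷ _ , _ , ewx ∷ _) , (w , refl , _ ∷ w≢y ∷ _)) = w , refl , vw , ewx , w≢y

module HamToSnaInstance (p m : ℕ) (gs : Fin (suc m) → List Pt)
  (conn : ∀ i → Connected (gs i)) (size : ∀ i → length (gs i) ≡ suc (suc (suc p)))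
  (c : Fin (suc m) → ℕ)
  (c∈ : ∀ i → (suc (suc (suc (suc p))) , c i) ∈ translate (suc (suc (suc p))) i (gs i)) where

  n r : ℕ
  n = suc (suc (suc p))
  r = suc (suc p)          -- the row n - 1 of the initial snake

  V : Pt → Set
  V = HamToSnaV n m gs c
  open Snake V adj
  open SnakeFacts V adj

  t : Fin (suc m)
  t = fromℕ m

  -- Connector columns: cᵢ lies in the band of Gᵢ, so distinct ones are ≥ 2 apart.
  band : Fin (suc m) → ℕ
  band i = suc (toℕ i) * suc n

  c-in-band : ∀ i → band i ≤ c i × c i < band i + n
  c-in-band i with translate-col n i (conn i) (c∈ i)
  ... | lo≤c , c<hi = lo≤c , subst (λ ℓ → c i < band i + ℓ) (size i) c<hi

  columns-apart : ∀ i k → toℕ i < toℕ k → suc (suc (c i)) ≤ c k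
  columns-apart i k i<k = begin
    suc (suc (c i))   ≤⟨ s≤s (proj₂ (c-in-band i)) ⟩
    suc (band i + n)  ≡⟨ cong suc (+-comm (band i) n) ⟩
    suc n + band i    ≤⟨ *-monoˡ-≤ (suc n) (s≤s i<k) ⟩
    band k            ≤⟨ proj₁ (c-in-band k) ⟩
    c k               ∎
    where open ≤-Reasoning

  connectors-not-adjacent : ∀ i k → suc (c i) ≢ c k
  connectors-not-adjacent i k 1+cᵢ≡cₖ with <-cmp (toℕ i) (toℕ k)
  ... | tri< i<k _ _ = n≮n (c k) (subst (_< c k) 1+cᵢ≡cₖ (columns-apart i k i<k))
  ... | tri≈ _ i≡k _ = 1+n≢n (trans 1+cᵢ≡cₖ (cong c (sym (toℕ-injective i≡k))))
  ... | tri> _ _ k<i = <-asym (subst (c i <_) 1+cᵢ≡cₖ (n<1+n (c i)))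
                             (≤-trans (n≤1+n (suc (c k))) (columns-apart k i k<i))

  n≤c : ∀ i → n ≤ c i
  n≤c i = ≤-trans (≤-trans (n≤1+n n) (m≤m+n (suc n) (toℕ i * suc n))) (proj₁ (c-in-band i))

  c≤last : ∀ i → c i ≤ c t
  c≤last i with m≤n⇒m<n∨m≡n (≤fromℕ i)
  ... | inj₁ i<t = ≤-trans (m≤n+m (c i) 2) (columns-apart i t i<t)
  ... | inj₂ i≡t rewrite toℕ-injective {i = i} {j = t} i≡t = ≤-refl

  r≤c : ∀ i → r ≤ c i
  r≤c i = ≤-trans (n≤1+n r) (n≤c i)

  connector-vertex : ∀ i → V (n , c i)
  connector-vertex i = inj₂ (inj₁ (inj₂ (i , refl)))

  not-translated : ∀ {a x i} → a ≤ n → ¬ (a , x) ∈ translate n i (gs i)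
  not-translated {i = i} a≤n q∈ = ≤⇒≯ a≤n (translate-row n i (gs i) q∈)

  row-r-vertex : ∀ {x} → x ≤ c t → V (r , x)
  row-r-vertex {x} x≤cₜ with x <? n
  ... | yes x<n = inj₁ (inj₁ (x , x<n , refl))
  ... | no  x≮n = inj₂ (inj₁ (inj₁ (x , ≮⇒≥ x≮n , x≤cₜ , refl)))

  row-n-vertex : ∀ {x} → V (n , x) → ∃[ i ] c i ≡ x
  row-n-vertex (inj₁ (inj₁ (_ , _ , ())))
  row-n-vertex (inj₁ (inj₂ (_ , n<n , refl))) = contradiction n<n (n≮n n)
  row-n-vertex (inj₂ (inj₁ (inj₁ (_ , _ , _ , ()))))
  row-n-vertex (inj₂ (inj₁ (inj₂ (i , refl)))) = i , refl
  row-n-vertex (inj₂ (inj₂ (_ , q∈))) = contradiction q∈ (not-translated ≤-refl)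

  row-n-isolated : ∀ {x} → V (n , x) → ¬ V (n , suc x)
  row-n-isolated vx vx+1 with row-n-vertex vx | row-n-vertex vx+1
  ... | i , cᵢ≡x | k , cₖ≡1+x = connectors-not-adjacent i k (trans (cong suc cᵢ≡x) (sym cₖ≡1+x))

  row-above-empty : ∀ {x} → r ≤ x → ¬ V (suc p , x)
  row-above-empty r≤x (inj₁ (inj₁ (_ , _ , ())))
  row-above-empty r≤x (inj₁ (inj₂ (_ , _ , refl))) = n≮n (suc p) r≤x
  row-above-empty r≤x (inj₂ (inj₁ (inj₁ (_ , _ , _ , ()))))
  row-above-empty r≤x (inj₂ (inj₁ (inj₂ (_ , ()))))
  row-above-empty r≤x (inj₂ (inj₂ (_ , q∈))) = not-translated (m≤n+m (suc p) 2) q∈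

  seg : ℕ → ℕ → List Pt
  seg h zero    = []
  seg h (suc k) = (r , h) ∷ seg (pred h) k

  seg-all : ∀ {P : Pt → Set} h k → (∀ x → x ≤ h → P (r , x)) → All P (seg h k)
  seg-all h zero    P-row = []
  seg-all h (suc k) P-row = P-row h ≤-refl ∷ seg-all (pred h) k (λ x x≤ → P-row x (≤-trans x≤ pred[n]≤n))

  seg-dropLast : ∀ h k → dropLast (seg h (suc k)) ≡ seg h k
  seg-dropLast h zero    = refl
  seg-dropLast h (suc k) = cong ((r , h) ∷_) (seg-dropLast (pred h) k)

  off-row : ∀ {a y} h k → a ≢ r → All ((a , y) ≢_) (seg h k)
  off-row h k a≢r = seg-all h k (λ _ _ same → a≢r (cong proj₁ same))

  config-seg : ∀ h k → k ≤ h → h ≤ c t → Config (suc k) (seg h (suc k))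
  config-seg h       zero    _         h≤cₜ = config-[ row-r-vertex h≤cₜ ]
  config-seg (suc h) (suc k) (s≤s k≤h) h≤cₜ =
    config-∷ (row-r-vertex h≤cₜ) (adj-left r h)
             (seg-all h (suc k) (λ x x≤h same → <⇒≢ (s≤s x≤h) (sym (cong proj₂ same))))
             (config-seg h k k≤h (≤-trans (n≤1+n h) h≤cₜ))

  -- The snake turning down at column x: after one step (mid) and after two
  -- steps (top, which is initᵢ when x = cᵢ).
  mid top : ℕ → List Pt
  mid x = (n , x) ∷ seg x r
  top x = (suc n , x) ∷ (n , x) ∷ seg x (suc p)

  config-mid : ∀ i → Config n (mid (c i))
  config-mid i = config-∷ (connector-vertex i) (adj-up r (c i)) (off-row (c i) r 1+n≢n)
    (config-seg (c i) (suc p) (≤-trans (m≤n+m (suc p) 2) (n≤c i)) (c≤last i))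

  config-top : ∀ i → Config n (top (c i))
  config-top i = config-∷ (inj₂ (inj₂ (i , c∈ i))) (adj-up n (c i))
      ((λ same → 1+n≢n (cong proj₁ same)) ∷ off-row (c i) (suc p) (λ ()))
    (config-∷ (connector-vertex i) (adj-up r (c i)) (off-row (c i) (suc p) 1+n≢n)
      (config-seg (c i) p (≤-trans (m≤n+m p 3) (n≤c i)) (c≤last i)))

  move-right : ∀ h → r ≤ h → suc h ≤ c t → Step n (seg h n) (seg (suc h) n)
  move-right h r≤h h<cₜ = advance (seg-dropLast h r)
    (config-seg h r r≤h (<⇒≤ h<cₜ)) (config-seg (suc h) r (m≤n⇒m≤1+n r≤h) h<cₜ)

  move-down : ∀ i → Step n (seg (c i) n) (mid (c i))
  move-down i = advance (seg-dropLast (c i) r) (config-seg (c i) r (r≤c i) (c≤last i)) (config-mid i)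

  move-down-again : ∀ i → Step n (mid (c i)) (top (c i))
  move-down-again i = advance (cong ((n , c i) ∷_) (seg-dropLast (c i) (suc p))) (config-mid i) (config-top i)

  walk-right : ∀ h → r ≤ h → h ≤ c t → Star (Step n) (seg r n) (seg h n)
  walk-right (suc h) r≤1+h h<cₜ with m≤n⇒m<n∨m≡n r≤1+h
  ... | inj₁ (s≤s r≤h) = walk-right h r≤h (<⇒≤ h<cₜ) ◅◅ (move-right h r≤h h<cₜ ◅ ε)
  ... | inj₂ refl      = ε

  forced-from-row : ∀ h → r ≤ h → ∀ {ys} → Step n (seg h n) ys
    → ys ≡ seg (suc h) n ⊎ ∃[ i ] (c i ≡ h × ys ≡ mid h)
  forced-from-row h r≤h s with new-head s
  ... | w , refl , vw , w~x , w≢y with adj⇒Neighbour {w} {r , h} w~x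
  ...   | right = contradiction refl w≢y
  ...   | left  = inj₁ (cong ((r , suc h) ∷_) (seg-dropLast h r))
  ...   | down  = contradiction vw (row-above-empty r≤h)
  ...   | up    with row-n-vertex vw
  ...     | i , cᵢ≡h = inj₂ (i , cᵢ≡h , cong ((n , h) ∷_) (seg-dropLast h r))

  forced-from-mid : ∀ {x ys} → V (n , x) → Step n (mid x) ys → ys ≡ top x
  forced-from-mid {x} vx s with new-head s
  ... | w , refl , vw , w~x , w≢y with adj⇒Neighbour {w} {n , x} w~x
  ...   | right = contradiction vx (row-n-isolated vw)
  ...   | left  = contradiction vw (row-n-isolated vx)
  ...   | down  = contradiction refl w≢y
  ...   | up    = cong (λ ys → (suc n , x) ∷ (n , x) ∷ ys) (seg-dropLast x (suc p))

  Finishes : List Pt → Set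
  Finishes s = YesInstance n s (finConf n)

  reaches-some-top : ∀ h → r ≤ h → TransClosure (Step n) (seg h n) (finConf n) → ∃[ i ] Finishes (top (c i))
  reaches-some-top h r≤h [ s ] with forced-from-row h r≤h s
  ... | inj₁ ()
  ... | inj₂ (_ , _ , ())
  reaches-some-top h r≤h (s ∷ run) with forced-from-row h r≤h s
  ... | inj₁ refl             = reaches-some-top (suc h) (m≤n⇒m≤1+n r≤h) run
  ... | inj₂ (i , refl , refl) = i , from-mid run
    where
    from-mid : TransClosure (Step n) (mid (c i)) (finConf n) → Finishes (top (c i))
    from-mid [ s′ ] with forced-from-mid (connector-vertex i) s′
    ... | ()
    from-mid (s′ ∷ run′) with forced-from-mid (connector-vertex i) s′
    ... | refl = Equivalence.from equivalent run′

  init-is-seg : initConf n ≡ seg r n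
  init-is-seg = listing n
    where
    listing : ∀ k → map (λ j → (r , j)) (downFrom k) ≡ seg (pred k) k
    listing zero    = refl
    listing (suc k) = cong ((r , k) ∷_) (listing k)

  initᵢ-is-top : ∀ i → initConfᵢ n (c i) ≡ top (c i)
  initᵢ-is-top i = cong (λ ys → (suc n , c i) ∷ (n , c i) ∷ ys)
    (trans (map-applyUpTo (λ j → j) (λ j → (r , c i ∸ j)) (suc p))
           (listing (c i) (suc p) (≤-trans (m≤n+m (suc p) 3) (s≤s (n≤c i)))))
    where
    listing : ∀ x k → k ≤ suc x → applyUpTo (λ j → (r , x ∸ j)) k ≡ seg x k
    listing x       zero          _         = refl
    listing zero    (suc zero)    _         = refl
    listing zero    (suc (suc k)) (s≤s ())
    listing (suc x) (suc k)       (s≤s k≤)  = cong ((r , suc x) ∷_) (listing x k k≤)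

  init⇒some-initᵢ : Finishes (initConf n) → ∃[ i ] Finishes (initConfᵢ n (c i))
  init⇒some-initᵢ solution with reaches-some-top r ≤-refl
                                 (Equivalence.to equivalent (subst Finishes init-is-seg solution))
  ... | i , finishes = i , subst Finishes (sym (initᵢ-is-top i)) finishes

  initᵢ⇒init : ∀ i → Finishes (initConfᵢ n (c i)) → Finishes (initConf n)
  initᵢ⇒init i finishes = subst Finishes (sym init-is-seg)
    (walk-right (c i) (r≤c i) (c≤last i) ◅◅⁺
      (_ ∼⁺⟨ [ move-down i ] ⟩ (_ ∼⁺⟨ [ move-down-again i ] ⟩ subst Finishes (initᵢ-is-top i) finishes)))

-- Lemma 4.7.
lemma4p7 : (n m : ℕ) → 3 ≤ n
    → (gs : Fin (suc m) → List Pt)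
    → (∀ i → Unique (gs i)) → (∀ i → Connected (gs i)) → (∀ i → length (gs i) ≡ n)
    → (c : Fin (suc m) → ℕ) → (∀ i → (suc n , c i) ∈ translate n i (gs i))
    → Snake.YesInstance (HamToSnaV n m gs c) adj n (initConf n) (finConf n)
      ⇔ (∃[ i ] Snake.YesInstance (HamToSnaV n m gs c) adj n (initConfᵢ n (c i)) (finConf n))
lemma4p7 (suc (suc (suc p))) m (s≤s (s≤s (s≤s z≤n))) gs _ conn size c c∈ =
  mk⇔ init⇒some-initᵢ (uncurry initᵢ⇒init)
  where open HamToSnaInstance p m gs conn size c c∈
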